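{- For every part listing $L$, the poset associated to $L$ is $(3+1)$-free, i.e. it contains no induced subposet isomorphic to the disjoint union of a $3$-element chain and a $1$-element chain.
   Context: A bicoloured graph is a finite graph whose vertices are coloured `down' or `up', with every edge joining a down vertex to an up vertex. A part listing is a finite ordered list of parts, each placed on positive integer levels: a part is either a single vertex on some level $i\ge 1$ (written $v_i$), or a copy of a bicoloured graph $G$ placed on two adjacent levels $i$ and $i+1$, with its down vertices on level $i$ and its up vertices on level $i+1$ (written $b_{i,i+1}(G)$). The vertex set of the listing is the union of the vertices of its parts. The poset associated to a part listing $L$ has this vertex set, with $x<y$ if and only if (i) $x$ is at least two levels below $y$; or (ii) $x$ is exactly one level below $y$ and the part containing $x$ appears strictly before the part containing $y$ in $L$; or (iii) $x$ is exactly one level below $y$ and $x,y$ are joined by an edge of a bicoloured graph part. -}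

module Defs where

open import Data.Nat using (ℕ; zero; suc; _+_; _<_; _≤_; NonZero)
open import Data.Fin using (Fin)
open import Data.Bool using (Bool; T)
open import Data.Unit using (⊤)
open import Data.Sum using (_⊎_; inj₁; inj₂)
open import Data.Product using (Σ; _×_; _,_)
open import Data.List using (List; length; lookup)
open import Data.Empty using (⊥)
open import Relation.Binary.PropositionalEquality using (_≡_)
open import Relation.Nullary using (¬_)

record BicolouredGraph : Set where
  field
    down : ℕ
    up   : ℕ
    edge : Fin down → Fin up → Bool
open BicolouredGraph public

data Part : Set where
  vtx : (i : ℕ) → .{{NonZero i}} → Part
  bic : (i : ℕ) → .{{NonZero i}} → BicolouredGraph → Part

PartVertex : Part → Set
PartVertex (vtx i) = ⊤
PartVertex (bic i G) = Fin (down G) ⊎ Fin (up G)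

level : (p : Part) → PartVertex p → ℕ
level (vtx i) _ = i
level (bic i G) (inj₁ _) = i
level (bic i G) (inj₂ _) = suc i

Joined : (p : Part) → PartVertex p → PartVertex p → Set
Joined (vtx i) _ _ = ⊥
Joined (bic i G) (inj₁ d) (inj₂ u) = T (edge G d u)
Joined (bic i G) _ _ = ⊥

PartListing : Set
PartListing = List Part

Vertex : PartListing → Set
Vertex L = Σ (Fin (length L)) λ k → PartVertex (lookup L k)

lvl : (L : PartListing) → Vertex L → ℕ
lvl L (k , x) = level (lookup L k) x

data Less (L : PartListing) : Vertex L → Vertex L → Set where
  twoBelow  : ∀ {x y} → lvl L x + 2 ≤ lvl L y → Less L x y
  partBefore : ∀ {k k' a b} →
               suc (lvl L (k , a)) ≡ lvl L (k' , b) →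
               Data.Fin._<_ k k' → Less L (k , a) (k' , b)
  viaEdge   : ∀ {k a b} →
               suc (lvl L (k , a)) ≡ lvl L (k , b) →
               Joined (lookup L k) a b → Less L (k , a) (k , b)

Incomparable : (L : PartListing) → Vertex L → Vertex L → Set
Incomparable L x y = ¬ Less L x y × ¬ Less L y x

-- The poset contains an induced subposet isomorphic to 3+1:
-- a 3-element chain a < b < c and an element d incomparable to each.
-- (Distinctness is automatic since the order is strict.)
Contains3+1 : PartListing → Set
Contains3+1 L = Σ (Vertex L) λ a → Σ (Vertex L) λ b → Σ (Vertex L) λ c →
  Σ (Vertex L) λ d →
  Less L a b × Less L b c ×
  Incomparable L a d × Incomparable L b d × Incomparable L c d

Free3+1 : PartListing → Set
Free3+1 L = ¬ Contains3+1 L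

-- The levels along a < b < c rise by at least two, while d, being incomparable
-- to a and to c, sits at most one level above a and at most one level below c.
-- Hence the levels are ℓ, ℓ+1, ℓ+2 for a, b, c and ℓ+1 for d, so every one of
-- the four relevant pairs is one level apart, where comparability is decided
-- by the order of the parts: a < b < c forces part(a) ≤ part(b) ≤ part(c), and
-- a ≮ d, d ≮ c force part(c) ≤ part(d) ≤ part(a). So a and c lie in one part,
-- which is impossible since a part spans at most two adjacent levels.
module Submission where

open import Defs
open import Data.Nat using (ℕ; suc; _+_; _<_; _≤_; s≤s)
open import Data.Nat.Properties
  using (≤-refl; ≤-trans; ≤-antisym; ≤-reflexive; ≤-pred; n≤1+n; m≤n⇒m≤1+n;
         +-comm; 1+n≰n; ≰⇒>; ≮⇒≥; <⇒≤; _≤?_)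
import Data.Fin as Fin
import Data.Fin.Properties as Fin
open import Data.Sum using (inj₁; inj₂)
open import Data.Product using (_×_; _,_)
open import Data.List using (lookup)
open import Relation.Binary.PropositionalEquality using (_≡_; refl; sym)
open import Relation.Nullary using (¬_; yes; no; contradiction)

level≤1+level : ∀ p (x y : PartVertex p) → level p x ≤ suc (level p y)
level≤1+level (vtx i)   _        _        = n≤1+n i
level≤1+level (bic i G) (inj₁ _) (inj₁ _) = n≤1+n i
level≤1+level (bic i G) (inj₁ _) (inj₂ _) = m≤n⇒m≤1+n (n≤1+n i)
level≤1+level (bic i G) (inj₂ _) (inj₁ _) = ≤-refl
level≤1+level (bic i G) (inj₂ _) (inj₂ _) = n≤1+n (suc i)

lvl≤1+lvl-samePart : ∀ L {k k′ a c} → k ≡ k′ → lvl L (k′ , c) ≤ suc (lvl L (k , a))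
lvl≤1+lvl-samePart L {k} {a = a} {c} refl = level≤1+level (lookup L k) c a

levels-of-3+1 : ∀ {a b c d : ℕ} → a < b → b < c → d ≤ suc a → c ≤ suc d →
                suc a ≡ b × suc b ≡ c × suc a ≡ d × suc d ≡ c
levels-of-3+1 {a} {b} {c} {d} a<b b<c d≤1+a c≤1+d =
  ≤-antisym a<b b≤1+a , ≤-antisym b<c (≤-trans c≤2+a (s≤s a<b)) ,
  ≤-antisym 1+a≤d d≤1+a , ≤-antisym (≤-trans (s≤s d≤1+a) 2+a≤c) c≤1+d
  where
  2+a≤c : suc (suc a) ≤ c
  2+a≤c = ≤-trans (s≤s a<b) b<c
  c≤2+a : c ≤ suc (suc a)
  c≤2+a = ≤-trans c≤1+d (s≤s d≤1+a)
  b≤1+a : b ≤ suc a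
  b≤1+a = ≤-pred (≤-trans b<c c≤2+a)
  1+a≤d : suc a ≤ d
  1+a≤d = ≤-pred (≤-trans 2+a≤c c≤1+d)

module _ {L : PartListing} where

  Less⇒lvl< : ∀ {x y} → Less L x y → lvl L x < lvl L y
  Less⇒lvl< {x} (twoBelow x+2≤y) =
    ≤-trans (n≤1+n _) (≤-trans (≤-reflexive (+-comm 2 (lvl L x))) x+2≤y)
  Less⇒lvl< (partBefore eq _) = ≤-reflexive eq
  Less⇒lvl< (viaEdge eq _)    = ≤-reflexive eq

  ≮⇒lvl≤1+lvl : ∀ {x y} → ¬ Less L x y → lvl L y ≤ suc (lvl L x)
  ≮⇒lvl≤1+lvl {x} {y} x≮y with lvl L x + 2 ≤? lvl L y
  ... | yes x+2≤y = contradiction (twoBelow x+2≤y) x≮y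
  ... | no  x+2≰y = ≤-pred (≤-trans (≰⇒> x+2≰y) (≤-reflexive (+-comm (lvl L x) 2)))

  Less-adjacent⇒part≤ : ∀ {k k′ a b} → suc (lvl L (k , a)) ≡ lvl L (k′ , b) →
                        Less L (k , a) (k′ , b) → k Fin.≤ k′
  Less-adjacent⇒part≤ {k} {a = a} eq (twoBelow x+2≤y) =
    contradiction (≤-trans (≤-reflexive (+-comm 2 (lvl L (k , a))))
                           (≤-trans x+2≤y (≤-reflexive (sym eq))))
                  1+n≰n
  Less-adjacent⇒part≤ _ (partBefore _ k<k′) = <⇒≤ k<k′
  Less-adjacent⇒part≤ _ (viaEdge _ _)       = ≤-refl

  ≮-adjacent⇒part≥ : ∀ {k k′ a b} → suc (lvl L (k , a)) ≡ lvl L (k′ , b) →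
                     ¬ Less L (k , a) (k′ , b) → k′ Fin.≤ k
  ≮-adjacent⇒part≥ {k} {k′} eq x≮y with k Fin.<? k′
  ... | yes k<k′ = contradiction (partBefore eq k<k′) x≮y
  ... | no  k≮k′ = ≮⇒≥ k≮k′

mainTheorem1 : (L : PartListing) → Free3+1 L
mainTheorem1 L ((ka , a) , (kb , b) , (kc , c) , (kd , d) ,
                a<b , b<c , (a≮d , _) , _ , (_ , d≮c))
  with levels-of-3+1 (Less⇒lvl< a<b) (Less⇒lvl< b<c) (≮⇒lvl≤1+lvl a≮d) (≮⇒lvl≤1+lvl d≮c)
... | a⋖b , b⋖c , a⋖d , d⋖c = contradiction (≤-trans c-twoAbove-a (lvl≤1+lvl-samePart L ka≡kc)) 1+n≰n
  where
  ka≡kc : ka ≡ kc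
  ka≡kc = Fin.≤-antisym
    (Fin.≤-trans (Less-adjacent⇒part≤ a⋖b a<b) (Less-adjacent⇒part≤ b⋖c b<c))
    (Fin.≤-trans (≮-adjacent⇒part≥ d⋖c d≮c) (≮-adjacent⇒part≥ a⋖d a≮d))

  c-twoAbove-a : suc (suc (lvl L (ka , a))) ≤ lvl L (kc , c)
  c-twoAbove-a = ≤-trans (s≤s (Less⇒lvl< a<b)) (Less⇒lvl< b<c)
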